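{- Let $k=k(n)$ be a function of $n$ with $k(n)/(2^n n)\to\infty$ as $n\to\infty$. Let $f(n,k)$ be the fraction of $n$-tuples $(B_1,\dots,B_n)$ of subsets of $\{1,\dots,k\}$ (among all $2^{nk}$ such tuples) for which the collection $\{B_1,\dots,B_n\}$ is $\frac12$-splittable. Then $f(n,k(n))\to1$ as $n\to\infty$.
   Context: A collection $\{B_1,\dots,B_n\}$ of finite sets is $\frac12$-splittable if there is a set $S$ with $|S\cap B_i|\in\{\lfloor |B_i|/2\rfloor,\lceil |B_i|/2\rceil\}$ for all $i$. -}

module Defs where

open import Data.Nat using (ℕ; zero; suc; _+_; ⌊_/2⌋; ⌈_/2⌉)
open import Data.Nat.Properties using (_≟_)
open import Data.Bool using (if_then_else_)
open import Data.Fin using (Fin)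
open import Data.Fin.Subset using (Subset; _∩_; ∣_∣; inside; outside)
open import Data.Fin.Subset.Properties using (anySubset?)
open import Data.Fin.Properties using (all?)
open import Data.Vec using (Vec; []; _∷_; lookup)
open import Data.Product using (∃-syntax; _,_)
open import Data.Sum using (_⊎_)
open import Relation.Binary.PropositionalEquality using (_≡_)
open import Relation.Nullary using (Dec; ⌊_⌋)
open import Relation.Nullary.Decidable using (_⊎-dec_)

HalfSplits : ∀ {k} → Subset k → Subset k → Set
HalfSplits S B = ∣ S ∩ B ∣ ≡ ⌊ ∣ B ∣ /2⌋ ⊎ ∣ S ∩ B ∣ ≡ ⌈ ∣ B ∣ /2⌉

-- The collection {B_1,…,B_n} of subsets of {1,…,k} is 1/2-splittable.
-- (S may be taken inside {1,…,k} w.l.o.g., since only S ∩ B_i matters.)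
Splittable : ∀ {n k} → Vec (Subset k) n → Set
Splittable {n} {k} Bs = ∃[ S ] (∀ (i : Fin n) → HalfSplits S (lookup Bs i))

halfSplits? : ∀ {k} (S B : Subset k) → Dec (HalfSplits S B)
halfSplits? S B = (∣ S ∩ B ∣ ≟ ⌊ ∣ B ∣ /2⌋) ⊎-dec (∣ S ∩ B ∣ ≟ ⌈ ∣ B ∣ /2⌉)

splittable? : ∀ {n k} (Bs : Vec (Subset k) n) → Dec (Splittable Bs)
splittable? Bs = anySubset? (λ S → all? (λ i → halfSplits? S (lookup Bs i)))

sumSubsets : ∀ k → (Subset k → ℕ) → ℕ
sumSubsets zero    f = f []
sumSubsets (suc k) f = sumSubsets k (λ S → f (inside ∷ S)) + sumSubsets k (λ S → f (outside ∷ S))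

sumTuples : ∀ n k → (Vec (Subset k) n → ℕ) → ℕ
sumTuples zero    k f = f []
sumTuples (suc n) k f = sumSubsets k (λ B → sumTuples n k (λ Bs → f (B ∷ Bs)))

-- Number of n-tuples of subsets of {1,…,k} whose collection is 1/2-splittable;
-- f(n,k) = splitCount n k / 2^(n k).
splitCount : ℕ → ℕ → ℕ
splitCount n k = sumTuples n k (λ Bs → if ⌊ splittable? Bs ⌋ then 1 else 0)

-- Read a tuple (B₁,…,Bₙ) of subsets of {1,…,k} as an n × k 0/1 matrix whose columns are vectors
-- of {0,1}ⁿ. If every vector of {0,1}ⁿ occurs as a column, the collection is splittable: induction
-- on n, splitting the columns by their first coordinate, arranges all columns but at most one into
-- pairs of vectors that differ in at most one coordinate, and putting exactly one column of each
-- pair into S, the right one chosen greedily, keeps every row balanced. A fixed vector is missing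
-- from all k columns of a uniformly random tuple with probability (1 − 2⁻ⁿ)ᵏ, so by the union bound
-- at most a fraction 2ⁿ(1 − 2⁻ⁿ)ᵏ of the tuples is not splittable, and this is at most 2⁻ⁿ once
-- k ≥ 2n2ⁿ, because Bernoulli's inequality gives (1 − 1/(a+1))^(a+1) ≤ 1/2.

module Submission where

open import Defs
open import Data.Nat using (ℕ; zero; suc; pred; _+_; _*_; _^_; _∸_; _≤_; _<_; _⊔_; ⌊_/2⌋; ⌈_/2⌉; z≤n; s≤s)
open import Data.Nat.Properties
open import Algebra.Properties.CommutativeSemigroup +-commutativeSemigroup using (interchange)
open import Data.Nat.ListAction using (sum)
open import Data.Nat.ListAction.Properties using (sum-↭)
open import Data.Nat.Tactic.RingSolver using (solve-∀)
open import Data.Bool using (Bool; true; false; not; _∧_; if_then_else_)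
open import Data.Bool.Properties using () renaming (_≟_ to _≟ᵇ_)
open import Data.Fin as Fin using (Fin)
open import Data.Fin.Properties using () renaming (_≟_ to _≟ᶠ_)
open import Data.Fin.Subset using (Subset; inside; outside; ⊥; _∩_; ∣_∣)
open import Data.Vec as Vec using (Vec; []; _∷_; head; tail; lookup; zipWith)
open import Data.Vec.Properties using (≡-dec; lookup-map)
open import Data.List using (List; []; _∷_; _++_; [_]; map)
open import Data.List.Properties using (∷-injective; ++-assoc; map-++)
open import Data.List.Membership.Propositional using (_∈_)
open import Data.List.Relation.Unary.Any using (here; there; any?)
open import Data.List.Relation.Binary.Permutation.Propositional using (_↭_; ↭-refl; ↭-sym; ↭-trans; ↭-reflexive; prep; swap; module PermutationReasoning)
open import Data.List.Relation.Binary.Permutation.Propositional.Properties using (↭-map-inv; map⁺; ++⁺; ++⁺ˡ; ++-comm; shift; shifts)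
open import Data.Product using (∃-syntax; _×_; _,_; proj₁)
open import Data.Sum using (_⊎_; inj₁; inj₂)
open import Function using (_∘_)
open import Relation.Nullary using (yes; no; does; ⌊_⌋; contradiction)
open import Relation.Binary.Definitions using (DecidableEquality)
open import Relation.Binary.PropositionalEquality hiding ([_])

indicator : Bool → ℕ
indicator b = if b then 1 else 0

sumSubsets-cong : ∀ k {f g : Subset k → ℕ} → (∀ S → f S ≡ g S) → sumSubsets k f ≡ sumSubsets k g
sumSubsets-cong zero    f≗g = f≗g []
sumSubsets-cong (suc k) f≗g =
  cong₂ _+_ (sumSubsets-cong k (f≗g ∘ (inside ∷_))) (sumSubsets-cong k (f≗g ∘ (outside ∷_)))

sumSubsets-mono-≤ : ∀ k {f g : Subset k → ℕ} → (∀ S → f S ≤ g S) → sumSubsets k f ≤ sumSubsets k g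
sumSubsets-mono-≤ zero    f≤g = f≤g []
sumSubsets-mono-≤ (suc k) f≤g =
  +-mono-≤ (sumSubsets-mono-≤ k (f≤g ∘ (inside ∷_))) (sumSubsets-mono-≤ k (f≤g ∘ (outside ∷_)))

sumSubsets-+ : ∀ k (f g : Subset k → ℕ) →
  sumSubsets k (λ S → f S + g S) ≡ sumSubsets k f + sumSubsets k g
sumSubsets-+ zero    f g = refl
sumSubsets-+ (suc k) f g = trans
  (cong₂ _+_ (sumSubsets-+ k (f ∘ (inside ∷_)) (g ∘ (inside ∷_)))
             (sumSubsets-+ k (f ∘ (outside ∷_)) (g ∘ (outside ∷_))))
  (interchange (sumSubsets k (f ∘ (inside ∷_))) (sumSubsets k (g ∘ (inside ∷_))) _ _)

sumSubsets-*ˡ : ∀ k a (f : Subset k → ℕ) → sumSubsets k (λ S → a * f S) ≡ a * sumSubsets k f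
sumSubsets-*ˡ zero    a f = refl
sumSubsets-*ˡ (suc k) a f = trans
  (cong₂ _+_ (sumSubsets-*ˡ k a (f ∘ (inside ∷_))) (sumSubsets-*ˡ k a (f ∘ (outside ∷_))))
  (sym (*-distribˡ-+ a _ _))

sumSubsets-*ʳ : ∀ k a (f : Subset k → ℕ) → sumSubsets k (λ S → f S * a) ≡ sumSubsets k f * a
sumSubsets-*ʳ zero    a f = refl
sumSubsets-*ʳ (suc k) a f = trans
  (cong₂ _+_ (sumSubsets-*ʳ k a (f ∘ (inside ∷_))) (sumSubsets-*ʳ k a (f ∘ (outside ∷_))))
  (sym (*-distribʳ-+ a (sumSubsets k (f ∘ (inside ∷_))) _))

sumSubsets-const : ∀ k c → sumSubsets k (λ _ → c) ≡ 2 ^ k * c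
sumSubsets-const zero    c = sym (+-identityʳ c)
sumSubsets-const (suc k) c = begin
  sumSubsets k (λ _ → c) + sumSubsets k (λ _ → c) ≡⟨ cong₂ _+_ (sumSubsets-const k c) (sumSubsets-const k c) ⟩
  2 ^ k * c + 2 ^ k * c                           ≡⟨ cong (2 ^ k * c +_) (sym (+-identityʳ (2 ^ k * c))) ⟩
  2 * (2 ^ k * c)                                 ≡⟨ sym (*-assoc 2 (2 ^ k) c) ⟩
  2 ^ suc k * c                                   ∎
  where open ≡-Reasoning

sumSubsets-comm : ∀ k m (h : Subset k → Subset m → ℕ) →
  sumSubsets k (λ B → sumSubsets m (h B)) ≡ sumSubsets m (λ C → sumSubsets k (λ B → h B C))
sumSubsets-comm zero    m h = refl
sumSubsets-comm (suc k) m h = trans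
  (cong₂ _+_ (sumSubsets-comm k m (h ∘ (inside ∷_))) (sumSubsets-comm k m (h ∘ (outside ∷_))))
  (sym (sumSubsets-+ m _ _))

sumSubsets≡0⇒≡0 : ∀ k {f : Subset k → ℕ} → sumSubsets k f ≡ 0 → ∀ S → f S ≡ 0
sumSubsets≡0⇒≡0 zero    sum≡0 []            = sum≡0
sumSubsets≡0⇒≡0 (suc k) sum≡0 (inside ∷ S)  = sumSubsets≡0⇒≡0 k (m+n≡0⇒m≡0 _ sum≡0) S
sumSubsets≡0⇒≡0 (suc k) sum≡0 (outside ∷ S) = sumSubsets≡0⇒≡0 k (m+n≡0⇒n≡0 (sumSubsets k _) sum≡0) S

sumTuples-cong : ∀ n k {f g : Vec (Subset k) n → ℕ} → (∀ Bs → f Bs ≡ g Bs) → sumTuples n k f ≡ sumTuples n k g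
sumTuples-cong zero    k f≗g = f≗g []
sumTuples-cong (suc n) k f≗g = sumSubsets-cong k (λ B → sumTuples-cong n k (f≗g ∘ (B ∷_)))

sumTuples-mono-≤ : ∀ n k {f g : Vec (Subset k) n → ℕ} → (∀ Bs → f Bs ≤ g Bs) → sumTuples n k f ≤ sumTuples n k g
sumTuples-mono-≤ zero    k f≤g = f≤g []
sumTuples-mono-≤ (suc n) k f≤g = sumSubsets-mono-≤ k (λ B → sumTuples-mono-≤ n k (f≤g ∘ (B ∷_)))

sumTuples-+ : ∀ n k (f g : Vec (Subset k) n → ℕ) →
  sumTuples n k (λ Bs → f Bs + g Bs) ≡ sumTuples n k f + sumTuples n k g
sumTuples-+ zero    k f g = refl
sumTuples-+ (suc n) k f g = trans (sumSubsets-cong k (λ B → sumTuples-+ n k _ _)) (sumSubsets-+ k _ _)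

sumTuples-*ˡ : ∀ n k a (f : Vec (Subset k) n → ℕ) → sumTuples n k (λ Bs → a * f Bs) ≡ a * sumTuples n k f
sumTuples-*ˡ zero    k a f = refl
sumTuples-*ˡ (suc n) k a f = trans (sumSubsets-cong k (λ B → sumTuples-*ˡ n k a _)) (sumSubsets-*ˡ k a _)

sumTuples-1 : ∀ n k → sumTuples n k (λ _ → 1) ≡ 2 ^ (n * k)
sumTuples-1 zero    k = refl
sumTuples-1 (suc n) k = begin
  sumSubsets k (λ _ → sumTuples n k (λ _ → 1)) ≡⟨ sumSubsets-cong k (λ _ → sumTuples-1 n k) ⟩
  sumSubsets k (λ _ → 2 ^ (n * k))             ≡⟨ sumSubsets-const k _ ⟩
  2 ^ k * 2 ^ (n * k)                          ≡⟨ sym (^-distribˡ-+-* 2 k (n * k)) ⟩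
  2 ^ (suc n * k)                              ∎
  where open ≡-Reasoning

sumTuples-sumSubsets : ∀ n k m (h : Subset m → Vec (Subset k) n → ℕ) →
  sumTuples n k (λ Bs → sumSubsets m (λ C → h C Bs)) ≡ sumSubsets m (λ C → sumTuples n k (h C))
sumTuples-sumSubsets zero    k m h = refl
sumTuples-sumSubsets (suc n) k m h =
  trans (sumSubsets-cong k (λ B → sumTuples-sumSubsets n k m _)) (sumSubsets-comm k m _)

sumTuples-zipWith-∷ : ∀ n k (f : Vec (Subset (suc k)) n → ℕ) →
  sumTuples n (suc k) f ≡ sumSubsets n (λ C → sumTuples n k (λ Bs → f (zipWith _∷_ C Bs)))
sumTuples-zipWith-∷ zero    k f = refl
sumTuples-zipWith-∷ (suc n) k f =
  cong₂ _+_ (trans (sumSubsets-cong k (λ B → sumTuples-zipWith-∷ n k _)) (sumSubsets-comm k n _))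
            (trans (sumSubsets-cong k (λ B → sumTuples-zipWith-∷ n k _)) (sumSubsets-comm k n _))

-- Columns and the vectors they miss

columns : ∀ {n} k → Vec (Subset k) n → List (Subset n)
columns zero    _  = []
columns (suc k) Bs = Vec.map head Bs ∷ columns k (Vec.map tail Bs)

map-head-zipWith-∷ : ∀ {n k} (C : Subset n) (Bs : Vec (Subset k) n) → Vec.map head (zipWith _∷_ C Bs) ≡ C
map-head-zipWith-∷ []      []       = refl
map-head-zipWith-∷ (c ∷ C) (B ∷ Bs) = cong (c ∷_) (map-head-zipWith-∷ C Bs)

map-tail-zipWith-∷ : ∀ {n k} (C : Subset n) (Bs : Vec (Subset k) n) → Vec.map tail (zipWith _∷_ C Bs) ≡ Bs
map-tail-zipWith-∷ []      []       = refl
map-tail-zipWith-∷ (c ∷ C) (B ∷ Bs) = cong (B ∷_) (map-tail-zipWith-∷ C Bs)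

columns-zipWith-∷ : ∀ {n} k (C : Subset n) (Bs : Vec (Subset k) n) →
  columns (suc k) (zipWith _∷_ C Bs) ≡ C ∷ columns k Bs
columns-zipWith-∷ k C Bs = cong₂ (λ D Ds → D ∷ columns k Ds) (map-head-zipWith-∷ C Bs) (map-tail-zipWith-∷ C Bs)

_≟ₛ_ : ∀ {n} → DecidableEquality (Subset n)
_≟ₛ_ = ≡-dec _≟ᵇ_

missing : ∀ {n} → Subset n → List (Subset n) → ℕ
missing t cs = indicator (not (does (any? (t ≟ₛ_) cs)))

missing-∷ : ∀ {n} (t c : Subset n) cs → missing t (c ∷ cs) ≡ indicator (not (does (t ≟ₛ c))) * missing t cs
missing-∷ t c cs with does (t ≟ₛ c)
... | true  = refl
... | false = sym (+-identityʳ (missing t cs))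

missing≡0⇒∈ : ∀ {n} (t : Subset n) cs → missing t cs ≡ 0 → t ∈ cs
missing≡0⇒∈ t cs missing≡0 with any? (t ≟ₛ_) cs
... | yes t∈cs = t∈cs
... | no  _    = contradiction missing≡0 1+n≢0

sumSubsets-≡ : ∀ n (t : Subset n) → sumSubsets n (λ C → indicator (does (t ≟ₛ C))) ≡ 1
sumSubsets-≡ zero    []            = refl
sumSubsets-≡ (suc n) (inside ∷ t)  = cong₂ _+_ (sumSubsets-≡ n t) (trans (sumSubsets-const n 0) (*-zeroʳ (2 ^ n)))
sumSubsets-≡ (suc n) (outside ∷ t) = cong₂ _+_ (trans (sumSubsets-const n 0) (*-zeroʳ (2 ^ n))) (sumSubsets-≡ n t)

sumSubsets-≢ : ∀ n (t : Subset n) → sumSubsets n (λ C → indicator (not (does (t ≟ₛ C)))) ≡ pred (2 ^ n)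
sumSubsets-≢ n t = cong pred (begin
  suc (sumSubsets n unequal)                      ≡⟨ +-comm 1 _ ⟩
  sumSubsets n unequal + 1                        ≡⟨ cong (sumSubsets n unequal +_) (sym (sumSubsets-≡ n t)) ⟩
  sumSubsets n unequal + sumSubsets n equal       ≡⟨ sym (sumSubsets-+ n unequal equal) ⟩
  sumSubsets n (λ C → unequal C + equal C)        ≡⟨ sumSubsets-cong n (λ C → not+id (does (t ≟ₛ C))) ⟩
  sumSubsets n (λ _ → 1)                          ≡⟨ trans (sumSubsets-const n 1) (*-identityʳ (2 ^ n)) ⟩
  2 ^ n                                           ∎)
  where
  open ≡-Reasoning
  equal unequal : Subset n → ℕ
  equal   C = indicator (does (t ≟ₛ C))
  unequal C = indicator (not (does (t ≟ₛ C)))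
  not+id : ∀ b → indicator (not b) + indicator b ≡ 1
  not+id true  = refl
  not+id false = refl

sumTuples-missing : ∀ n k (t : Subset n) → sumTuples n k (λ Bs → missing t (columns k Bs)) ≡ pred (2 ^ n) ^ k
sumTuples-missing n zero    t = trans (sumTuples-1 n 0) (cong (2 ^_) (*-zeroʳ n))
sumTuples-missing n (suc k) t = begin
  sumTuples n (suc k) (λ Bs → missing t (columns (suc k) Bs))
    ≡⟨ sumTuples-zipWith-∷ n k _ ⟩
  sumSubsets n (λ C → sumTuples n k (λ Bs → missing t (columns (suc k) (zipWith _∷_ C Bs))))
    ≡⟨ sumSubsets-cong n (λ C → sumTuples-cong n k (λ Bs →
         trans (cong (missing t) (columns-zipWith-∷ k C Bs)) (missing-∷ t C (columns k Bs)))) ⟩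
  sumSubsets n (λ C → sumTuples n k (λ Bs → unequal C * missing t (columns k Bs)))
    ≡⟨ sumSubsets-cong n (λ C → sumTuples-*ˡ n k (unequal C) _) ⟩
  sumSubsets n (λ C → unequal C * sumTuples n k (λ Bs → missing t (columns k Bs)))
    ≡⟨ sumSubsets-*ʳ n _ unequal ⟩
  sumSubsets n unequal * sumTuples n k (λ Bs → missing t (columns k Bs))
    ≡⟨ cong₂ _*_ (sumSubsets-≢ n t) (sumTuples-missing n k t) ⟩
  pred (2 ^ n) ^ suc k ∎
  where
  open ≡-Reasoning
  unequal : Subset n → ℕ
  unequal C = indicator (not (does (t ≟ₛ C)))

Half : ℕ → ℕ → Set
Half a b = a ≡ ⌊ b /2⌋ ⊎ a ≡ ⌈ b /2⌉

Half-suc-suc : ∀ {a b} → Half a b → Half (suc a) (suc (suc b))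
Half-suc-suc (inj₁ a≡⌊b/2⌋) = inj₁ (cong suc a≡⌊b/2⌋)
Half-suc-suc (inj₂ a≡⌈b/2⌉) = inj₂ (cong suc a≡⌈b/2⌉)

Half-suc : ∀ {a b} → Half a b → Half (suc a) (suc b) ⊎ Half a (suc b)
Half-suc (inj₁ a≡⌊b/2⌋) = inj₁ (inj₂ (cong suc a≡⌊b/2⌋))
Half-suc (inj₂ a≡⌈b/2⌉) = inj₂ (inj₁ a≡⌈b/2⌉)

Half-pair-same : ∀ {a b} c p → Half a b →
  Half (indicator (c ∧ p) + (indicator (not c ∧ p) + a)) (indicator p + (indicator p + b))
Half-pair-same true  true  = Half-suc-suc
Half-pair-same true  false = λ h → h
Half-pair-same false true  = Half-suc-suc
Half-pair-same false false = λ h → h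

Half-pair : ∀ {a b} p q → Half a b →
  ∃[ c ] Half (indicator (c ∧ p) + (indicator (not c ∧ q) + a)) (indicator p + (indicator q + b))
Half-pair true  true  h = true , Half-pair-same true true h
Half-pair false false h = true , h
Half-pair true  false h with Half-suc h
... | inj₁ h′ = true  , h′
... | inj₂ h′ = false , h′
Half-pair false true  h with Half-suc h
... | inj₁ h′ = false , h′
... | inj₂ h′ = true  , h′

-- A column together with whether its index belongs to S.
LabelledColumns : ℕ → Set
LabelledColumns n = List (Subset n × Bool)

chosenInRow onesInRow : ∀ {n} → Fin n → LabelledColumns n → ℕ
chosenInRow i = sum ∘ map (λ (t , c) → indicator (c ∧ lookup t i))
onesInRow   i = sum ∘ map (λ (t , _) → indicator (lookup t i))

Balanced : ∀ {n} → LabelledColumns n → Set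
Balanced zs = ∀ i → Half (chosenInRow i zs) (onesInRow i zs)

Balanceable : ∀ {n} → List (Subset n) → Set
Balanceable cs = ∃[ zs ] map proj₁ zs ≡ cs × Balanced zs

Balanced-↭ : ∀ {n} {zs zs′ : LabelledColumns n} → zs ↭ zs′ → Balanced zs → Balanced zs′
Balanced-↭ zs↭zs′ balanced i =
  subst₂ Half (sum-↭ (map⁺ _ zs↭zs′)) (sum-↭ (map⁺ _ zs↭zs′)) (balanced i)

Balanceable-↭ : ∀ {n} {cs ds : List (Subset n)} → cs ↭ ds → Balanceable cs → Balanceable ds
Balanceable-↭ cs↭ds (zs , refl , balanced) with ↭-map-inv proj₁ cs↭ds
... | zs′ , ds≡ , zs↭zs′ = zs′ , sym ds≡ , Balanced-↭ zs↭zs′ balanced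

Balanceable-[] : ∀ {n} → Balanceable {n} []
Balanceable-[] = [] , refl , λ _ → inj₁ refl

Balanceable-[_] : ∀ {n} (x : Subset n) → Balanceable [ x ]
Balanceable-[ x ] = [ (x , true) ] , refl , λ i → one (lookup x i)
  where
  one : ∀ p → Half (indicator (true ∧ p) + 0) (indicator p + 0)
  one true  = inj₂ refl
  one false = inj₁ refl

Adjacent : ∀ {n} → Subset n → Subset n → Set
Adjacent {n} x y = x ≡ y ⊎ ∃[ j ] (∀ (i : Fin n) → i ≢ j → lookup x i ≡ lookup y i)

Adjacent-∷ : ∀ {n} b {x y : Subset n} → Adjacent x y → Adjacent (b ∷ x) (b ∷ y)
Adjacent-∷ b (inj₁ refl)         = inj₁ refl
Adjacent-∷ b (inj₂ (j , agree)) = inj₂ (Fin.suc j , λ where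
  Fin.zero    _   → refl
  (Fin.suc i) i≢j → agree i (i≢j ∘ cong Fin.suc))

Adjacent-head : ∀ {n} (x : Subset n) → Adjacent (outside ∷ x) (inside ∷ x)
Adjacent-head x = inj₂ (Fin.zero , λ where
  Fin.zero    0≢0 → contradiction refl 0≢0
  (Fin.suc i) _   → refl)

-- Exactly one of x, y goes into S: rows where they agree gain 0 of 0 or 1 of 2, and the one row
-- where they may differ gains 1 of 1 or 0 of 1, whichever keeps it balanced.
Balanced-pair : ∀ {n} {x y : Subset n} {zs} → Adjacent x y → Balanced zs →
  ∃[ c ] Balanced ((x , c) ∷ (y , not c) ∷ zs)
Balanced-pair {x = x} (inj₁ refl) balanced = true , λ i → Half-pair-same true (lookup x i) (balanced i)
Balanced-pair {x = x} {y} {zs} (inj₂ (j , agree)) balanced with Half-pair (lookup x j) (lookup y j) (balanced j)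
... | c , balanced-j = c , balanced′
  where
  balanced′ : Balanced ((x , c) ∷ (y , not c) ∷ zs)
  balanced′ i with i ≟ᶠ j
  ... | yes refl = balanced-j
  ... | no  i≢j rewrite agree i i≢j = Half-pair-same c (lookup y i) (balanced i)

-- Pairing up a list of columns that contains every vector

data Pairing {n} : List (Subset n) → Set where
  []  : Pairing []
  _∷_ : ∀ {x y ds} → Adjacent x y → Pairing ds → Pairing (x ∷ y ∷ ds)

Pairing-++ : ∀ {n} {ds es : List (Subset n)} → Pairing ds → Pairing es → Pairing (ds ++ es)
Pairing-++ []             q = q
Pairing-++ (adjacent ∷ p) q = adjacent ∷ Pairing-++ p q

Pairing-map : ∀ {n} b {ds : List (Subset n)} → Pairing ds → Pairing (map (b ∷_) ds)
Pairing-map b []             = []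
Pairing-map b (adjacent ∷ p) = Adjacent-∷ b adjacent ∷ Pairing-map b p

Pairing-Balanceable : ∀ {n} {ds cs : List (Subset n)} → Pairing ds → Balanceable cs → Balanceable (ds ++ cs)
Pairing-Balanceable []                       balanceable = balanceable
Pairing-Balanceable {ds = x ∷ y ∷ _} (adjacent ∷ p) balanceable with Pairing-Balanceable p balanceable
... | zs , zs-labels , balanced with Balanced-pair {zs = zs} adjacent balanced
... | c , balanced′ = (x , c) ∷ (y , not c) ∷ zs , cong (λ l → x ∷ y ∷ l) zs-labels , balanced′

PairableExcept : ∀ {n} → List (Subset n) → List (Subset n) → Set
PairableExcept xs cs = ∃[ ds ] cs ↭ xs ++ ds × Pairing ds

PairableExcept-Balanceable : ∀ {n} {xs cs : List (Subset n)} →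
  PairableExcept xs cs → Balanceable xs → Balanceable cs
PairableExcept-Balanceable {xs = xs} (ds , cs↭xs++ds , p) balanceable =
  Balanceable-↭ (↭-sym (↭-trans cs↭xs++ds (++-comm xs ds))) (Pairing-Balanceable p balanceable)

PairableExcept-↭ : ∀ {n} {xs cs cs′ : List (Subset n)} → cs ↭ cs′ → PairableExcept xs cs → PairableExcept xs cs′
PairableExcept-↭ cs↭cs′ (ds , cs↭ , p) = ds , ↭-trans (↭-sym cs↭cs′) cs↭ , p

PairableExcept-reorder : ∀ {n} {xs xs′ cs : List (Subset n)} → xs ↭ xs′ → PairableExcept xs cs → PairableExcept xs′ cs
PairableExcept-reorder xs↭xs′ (ds , cs↭ , p) = ds , ↭-trans cs↭ (++⁺ xs↭xs′ ↭-refl) , p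

PairableExcept-++ : ∀ {n} {xs ys cs es : List (Subset n)} →
  PairableExcept xs cs → PairableExcept ys es → PairableExcept (xs ++ ys) (cs ++ es)
PairableExcept-++ {xs = xs} {ys} (ds , cs↭ , p) (es′ , es↭ , q) = ds ++ es′ , ↭-trans (++⁺ cs↭ es↭) (begin
  (xs ++ ds) ++ ys ++ es′   ≡⟨ ++-assoc xs ds (ys ++ es′) ⟩
  xs ++ ds ++ ys ++ es′     ↭⟨ ++⁺ˡ xs (shifts ds ys) ⟩
  xs ++ ys ++ ds ++ es′     ≡⟨ ++-assoc xs ys (ds ++ es′) ⟨
  (xs ++ ys) ++ ds ++ es′   ∎) , Pairing-++ p q
  where open PermutationReasoning

PairableExcept-prepend : ∀ {n} {x y : Subset n} {xs cs} → Adjacent x y →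
  PairableExcept xs cs → PairableExcept xs (x ∷ y ∷ cs)
PairableExcept-prepend adjacent = PairableExcept-++ (_ , ↭-refl , adjacent ∷ [])

PairableExcept-map : ∀ {n} b {xs cs : List (Subset n)} →
  PairableExcept xs cs → PairableExcept (map (b ∷_) xs) (map (b ∷_) cs)
PairableExcept-map b {xs} (ds , cs↭ , p) =
  map (b ∷_) ds , ↭-trans (map⁺ (b ∷_) cs↭) (↭-reflexive (map-++ (b ∷_) xs ds)) , Pairing-map b p

PairableExcept-drop : ∀ {n} {x y : Subset n} {ys cs} → Adjacent x y → ∀ xs →
  PairableExcept (xs ++ x ∷ y ∷ ys) cs → PairableExcept (xs ++ ys) cs
PairableExcept-drop {x = x} {y} {ys} adjacent xs (ds , cs↭ , p) = x ∷ y ∷ ds , ↭-trans cs↭ (begin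
  (xs ++ x ∷ y ∷ ys) ++ ds      ≡⟨ ++-assoc xs (x ∷ y ∷ ys) ds ⟩
  xs ++ (x ∷ y ∷ []) ++ ys ++ ds ↭⟨ ++⁺ˡ xs (shifts (x ∷ y ∷ []) ys) ⟩
  xs ++ ys ++ x ∷ y ∷ ds         ≡⟨ ++-assoc xs ys (x ∷ y ∷ ds) ⟨
  (xs ++ ys) ++ x ∷ y ∷ ds       ∎) , adjacent ∷ p
  where open PermutationReasoning

-- ⊥ with its first coordinate switched on; it is adjacent to ⊥ in every dimension, including 0.
firstUnit : ∀ n → Subset n
firstUnit zero    = []
firstUnit (suc n) = inside ∷ ⊥

-- Two leftover patterns are tracked for each parity so that the halves of a cube can always be
-- glued: the leftovers of the two halves can then be matched as pairs (outside ∷ x , inside ∷ x).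
EvenPairable OddPairable : ∀ {n} → List (Subset n) → Set
EvenPairable {n} cs = PairableExcept [] cs × PairableExcept (⊥ ∷ firstUnit n ∷ []) cs
OddPairable  {n} cs = PairableExcept [ ⊥ ] cs × PairableExcept [ firstUnit n ] cs

Pairable : ∀ {n} → List (Subset n) → Set
Pairable cs = EvenPairable cs ⊎ OddPairable cs

Pairable-↭ : ∀ {n} {cs cs′ : List (Subset n)} → cs ↭ cs′ → Pairable cs → Pairable cs′
Pairable-↭ cs↭cs′ (inj₁ (p , q)) = inj₁ (PairableExcept-↭ cs↭cs′ p , PairableExcept-↭ cs↭cs′ q)
Pairable-↭ cs↭cs′ (inj₂ (p , q)) = inj₂ (PairableExcept-↭ cs↭cs′ p , PairableExcept-↭ cs↭cs′ q)

Pairable-Balanceable : ∀ {n} {cs : List (Subset n)} → Pairable cs → Balanceable cs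
Pairable-Balanceable (inj₁ (p , _)) = PairableExcept-Balanceable p Balanceable-[]
Pairable-Balanceable (inj₂ (p , _)) = PairableExcept-Balanceable p Balanceable-[ ⊥ ]

Pairable-prepend : ∀ {n} {x y : Subset n} {cs} → Adjacent x y → Pairable cs → Pairable (x ∷ y ∷ cs)
Pairable-prepend adjacent (inj₁ (p , q)) = inj₁ (PairableExcept-prepend adjacent p , PairableExcept-prepend adjacent q)
Pairable-prepend adjacent (inj₂ (p , q)) = inj₂ (PairableExcept-prepend adjacent p , PairableExcept-prepend adjacent q)

Pairable-dim0 : ∀ (x : Subset 0) cs → Pairable (x ∷ cs)
Pairable-dim0 [] []            = inj₂ ((_ , ↭-refl , []) , (_ , ↭-refl , []))
Pairable-dim0 [] ([] ∷ [])     = inj₁ ((_ , ↭-refl , inj₁ refl ∷ []) , (_ , ↭-refl , []))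
Pairable-dim0 [] ([] ∷ z ∷ cs) = Pairable-prepend (inj₁ refl) (Pairable-dim0 z cs)

PairableExcept-halves : ∀ {n} {xs ys os is : List (Subset n)} → PairableExcept xs os → PairableExcept ys is →
  PairableExcept (map (outside ∷_) xs ++ map (inside ∷_) ys) (map (outside ∷_) os ++ map (inside ∷_) is)
PairableExcept-halves p q = PairableExcept-++ (PairableExcept-map outside p) (PairableExcept-map inside q)

Pairable-halves : ∀ {n} {os is : List (Subset n)} → Pairable os → Pairable is →
  Pairable (map (outside ∷_) os ++ map (inside ∷_) is)
Pairable-halves {n} (inj₁ (o₁ , o₂)) (inj₁ (i₁ , i₂)) = inj₁
  ( PairableExcept-halves o₁ i₁
  , PairableExcept-drop (Adjacent-head (firstUnit n)) ((outside ∷ ⊥) ∷ (inside ∷ ⊥) ∷ [])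
      (PairableExcept-reorder (prep _ (swap _ _ ↭-refl)) (PairableExcept-halves o₂ i₂)))
Pairable-halves (inj₂ (o₁ , _)) (inj₂ (i₁ , _)) = inj₁
  ( PairableExcept-drop (Adjacent-head ⊥) [] (PairableExcept-halves o₁ i₁)
  , PairableExcept-halves o₁ i₁)
Pairable-halves {n} (inj₂ (o₁ , o₂)) (inj₁ (i₁ , i₂)) = inj₂
  ( PairableExcept-halves o₁ i₁
  , PairableExcept-drop (Adjacent-head (firstUnit n)) [ inside ∷ ⊥ ]
      (PairableExcept-reorder (swap _ _ ↭-refl) (PairableExcept-halves o₂ i₂)))
Pairable-halves {n} (inj₁ (o₁ , o₂)) (inj₂ (i₁ , i₂)) = inj₂
  ( PairableExcept-drop (Adjacent-head (firstUnit n)) [ outside ∷ ⊥ ] (PairableExcept-halves o₂ i₂)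
  , PairableExcept-halves o₁ i₁)

outsideTails insideTails : ∀ {n} → List (Subset (suc n)) → List (Subset n)
outsideTails []                  = []
outsideTails ((outside ∷ t) ∷ cs) = t ∷ outsideTails cs
outsideTails ((inside  ∷ t) ∷ cs) = outsideTails cs
insideTails []                   = []
insideTails ((outside ∷ t) ∷ cs) = insideTails cs
insideTails ((inside  ∷ t) ∷ cs) = t ∷ insideTails cs

↭-halves : ∀ {n} (cs : List (Subset (suc n))) →
  cs ↭ map (outside ∷_) (outsideTails cs) ++ map (inside ∷_) (insideTails cs)
↭-halves []                   = ↭-refl
↭-halves ((outside ∷ t) ∷ cs) = prep _ (↭-halves cs)
↭-halves ((inside  ∷ t) ∷ cs) =
  ↭-trans (prep _ (↭-halves cs)) (↭-sym (shift (inside ∷ t) (map (outside ∷_) (outsideTails cs)) _))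

∈-outsideTails : ∀ {n} {t : Subset n} {cs} → (outside ∷ t) ∈ cs → t ∈ outsideTails cs
∈-outsideTails {cs = _ ∷ _}             (here refl) = here refl
∈-outsideTails {cs = (outside ∷ _) ∷ _} (there t∈) = there (∈-outsideTails t∈)
∈-outsideTails {cs = (inside  ∷ _) ∷ _} (there t∈) = ∈-outsideTails t∈

∈-insideTails : ∀ {n} {t : Subset n} {cs} → (inside ∷ t) ∈ cs → t ∈ insideTails cs
∈-insideTails {cs = _ ∷ _}             (here refl) = here refl
∈-insideTails {cs = (outside ∷ _) ∷ _} (there t∈) = ∈-insideTails t∈
∈-insideTails {cs = (inside  ∷ _) ∷ _} (there t∈) = there (∈-insideTails t∈)

covering⇒Pairable : ∀ n (cs : List (Subset n)) → (∀ t → t ∈ cs) → Pairable cs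
covering⇒Pairable zero    []       covering with covering []
... | ()
covering⇒Pairable zero    (x ∷ cs) _        = Pairable-dim0 x cs
covering⇒Pairable (suc n) cs       covering = Pairable-↭ (↭-sym (↭-halves cs)) (Pairable-halves
  (covering⇒Pairable n (outsideTails cs) (λ t → ∈-outsideTails (covering (outside ∷ t))))
  (covering⇒Pairable n (insideTails cs)  (λ t → ∈-insideTails (covering (inside ∷ t)))))

labelledColumns : ∀ {n} k → Vec (Subset k) n → Subset k → LabelledColumns n
labelledColumns zero    _  []      = []
labelledColumns (suc k) Bs (c ∷ S) = (Vec.map head Bs , c) ∷ labelledColumns k (Vec.map tail Bs) S

labelledColumns-surjective : ∀ {n} k (Bs : Vec (Subset k) n) zs →
  map proj₁ zs ≡ columns k Bs → ∃[ S ] labelledColumns k Bs S ≡ zs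
labelledColumns-surjective zero    Bs []             _ = [] , refl
labelledColumns-surjective (suc k) Bs ((t , c) ∷ zs) zs-labels with ∷-injective zs-labels
... | refl , zs-labels′ with labelledColumns-surjective k (Vec.map tail Bs) zs zs-labels′
... | S , refl = c ∷ S , refl

∣∷∩∣ : ∀ {k} c (S : Subset k) (B : Subset (suc k)) → ∣ (c ∷ S) ∩ B ∣ ≡ indicator (c ∧ head B) + ∣ S ∩ tail B ∣
∣∷∩∣ true  S (true  ∷ B) = refl
∣∷∩∣ true  S (false ∷ B) = refl
∣∷∩∣ false S (b     ∷ B) = refl

∣∷∣ : ∀ {k} (B : Subset (suc k)) → ∣ B ∣ ≡ indicator (head B) + ∣ tail B ∣
∣∷∣ (true  ∷ B) = refl
∣∷∣ (false ∷ B) = refl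

chosenInRow-labelledColumns : ∀ {n} k (Bs : Vec (Subset k) n) S i →
  chosenInRow i (labelledColumns k Bs S) ≡ ∣ S ∩ lookup Bs i ∣
chosenInRow-labelledColumns zero    Bs []      i with lookup Bs i
... | [] = refl
chosenInRow-labelledColumns (suc k) Bs (c ∷ S) i = begin
  indicator (c ∧ lookup (Vec.map head Bs) i) + chosenInRow i (labelledColumns k (Vec.map tail Bs) S)
    ≡⟨ cong₂ (λ b n → indicator (c ∧ b) + n) (lookup-map i head Bs) (chosenInRow-labelledColumns k _ S i) ⟩
  indicator (c ∧ head (lookup Bs i)) + ∣ S ∩ lookup (Vec.map tail Bs) i ∣
    ≡⟨ cong (λ B → indicator (c ∧ head (lookup Bs i)) + ∣ S ∩ B ∣) (lookup-map i tail Bs) ⟩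
  indicator (c ∧ head (lookup Bs i)) + ∣ S ∩ tail (lookup Bs i) ∣
    ≡⟨ ∣∷∩∣ c S (lookup Bs i) ⟨
  ∣ (c ∷ S) ∩ lookup Bs i ∣ ∎
  where open ≡-Reasoning

onesInRow-labelledColumns : ∀ {n} k (Bs : Vec (Subset k) n) S i →
  onesInRow i (labelledColumns k Bs S) ≡ ∣ lookup Bs i ∣
onesInRow-labelledColumns zero    Bs []      i with lookup Bs i
... | [] = refl
onesInRow-labelledColumns (suc k) Bs (c ∷ S) i = begin
  indicator (lookup (Vec.map head Bs) i) + onesInRow i (labelledColumns k (Vec.map tail Bs) S)
    ≡⟨ cong₂ (λ b n → indicator b + n) (lookup-map i head Bs) (onesInRow-labelledColumns k _ S i) ⟩
  indicator (head (lookup Bs i)) + ∣ lookup (Vec.map tail Bs) i ∣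
    ≡⟨ cong (λ B → indicator (head (lookup Bs i)) + ∣ B ∣) (lookup-map i tail Bs) ⟩
  indicator (head (lookup Bs i)) + ∣ tail (lookup Bs i) ∣
    ≡⟨ ∣∷∣ (lookup Bs i) ⟨
  ∣ lookup Bs i ∣ ∎
  where open ≡-Reasoning

Balanceable-columns⇒Splittable : ∀ {n} k (Bs : Vec (Subset k) n) → Balanceable (columns k Bs) → Splittable Bs
Balanceable-columns⇒Splittable k Bs (zs , zs-labels , balanced) with labelledColumns-surjective k Bs zs zs-labels
... | S , refl = S , λ i →
  subst₂ Half (chosenInRow-labelledColumns k Bs S i) (onesInRow-labelledColumns k Bs S i) (balanced i)

covering-columns⇒Splittable : ∀ {n} k (Bs : Vec (Subset k) n) → (∀ t → t ∈ columns k Bs) → Splittable Bs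
covering-columns⇒Splittable {n} k Bs covering =
  Balanceable-columns⇒Splittable k Bs (Pairable-Balanceable (covering⇒Pairable n (columns k Bs) covering))

splittable-or-missing : ∀ n k (Bs : Vec (Subset k) n) →
  1 ≤ indicator ⌊ splittable? Bs ⌋ + sumSubsets n (λ t → missing t (columns k Bs))
splittable-or-missing n k Bs with splittable? Bs
... | yes _ = s≤s z≤n
... | no ¬splittable with sumSubsets n (λ t → missing t (columns k Bs)) in sum≡
...   | suc _ = s≤s z≤n
...   | zero  = contradiction
  (covering-columns⇒Splittable k Bs (λ t → missing≡0⇒∈ t _ (sumSubsets≡0⇒≡0 n sum≡ t))) ¬splittable

splitCount-union-bound : ∀ n k → 2 ^ (n * k) ≤ splitCount n k + 2 ^ n * pred (2 ^ n) ^ k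
splitCount-union-bound n k = begin
  2 ^ (n * k)
    ≡⟨ sumTuples-1 n k ⟨
  sumTuples n k (λ _ → 1)
    ≤⟨ sumTuples-mono-≤ n k (splittable-or-missing n k) ⟩
  sumTuples n k (λ Bs → indicator ⌊ splittable? Bs ⌋ + sumSubsets n (λ t → missing t (columns k Bs)))
    ≡⟨ sumTuples-+ n k _ _ ⟩
  splitCount n k + sumTuples n k (λ Bs → sumSubsets n (λ t → missing t (columns k Bs)))
    ≡⟨ cong (splitCount n k +_) (sumTuples-sumSubsets n k n _) ⟩
  splitCount n k + sumSubsets n (λ t → sumTuples n k (λ Bs → missing t (columns k Bs)))
    ≡⟨ cong (splitCount n k +_) (sumSubsets-cong n (sumTuples-missing n k)) ⟩
  splitCount n k + sumSubsets n (λ _ → pred (2 ^ n) ^ k)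
    ≡⟨ cong (splitCount n k +_) (sumSubsets-const n _) ⟩
  splitCount n k + 2 ^ n * pred (2 ^ n) ^ k ∎
  where open ≤-Reasoning

-- Bernoulli-type estimates

bernoulli : ∀ a r → a ^ suc r + suc r * a ^ r ≤ suc a ^ suc r
bernoulli a zero    = ≤-reflexive (+-comm (a * 1) 1)
bernoulli a (suc r) = begin
  a ^ suc (suc r) + suc (suc r) * a ^ suc r                              ≤⟨ m≤m+n _ _ ⟩
  a * (a * a ^ r) + (2 + r) * (a * a ^ r) + (1 + r) * a ^ r               ≡⟨ expand a r (a ^ r) ⟨
  suc a * (a ^ suc r + suc r * a ^ r)                                     ≤⟨ *-monoʳ-≤ (suc a) (bernoulli a r) ⟩
  suc a ^ suc (suc r)                                                     ∎
  where
  open ≤-Reasoning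
  expand : ∀ a r X → (1 + a) * (a * X + (1 + r) * X) ≡ (a * (a * X) + (2 + r) * (a * X)) + (1 + r) * X
  expand = solve-∀

bernoulli-halving : ∀ a → 2 * a ^ suc a ≤ suc a ^ suc a
bernoulli-halving a = begin
  2 * a ^ suc a               ≡⟨ cong (a ^ suc a +_) (+-identityʳ (a ^ suc a)) ⟩
  a ^ suc a + a * a ^ a       ≤⟨ +-monoʳ-≤ (a ^ suc a) (*-monoˡ-≤ (a ^ a) (n≤1+n a)) ⟩
  a ^ suc a + suc a * a ^ a   ≤⟨ bernoulli a a ⟩
  suc a ^ suc a               ∎
  where open ≤-Reasoning

bernoulli-halving-iterated : ∀ a j r → 2 ^ j * a ^ (j * suc a + r) ≤ suc a ^ (j * suc a + r)
bernoulli-halving-iterated a zero    r = ≤-trans (≤-reflexive (+-identityʳ _)) (^-monoˡ-≤ r (n≤1+n a))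
bernoulli-halving-iterated a (suc j) r = begin
  2 ^ suc j * a ^ ((suc a + j * suc a) + r)   ≡⟨ cong (λ e → 2 ^ suc j * a ^ e) (+-assoc (suc a) (j * suc a) r) ⟩
  2 ^ suc j * a ^ (suc a + e)                 ≡⟨ cong (2 ^ suc j *_) (^-distribˡ-+-* a (suc a) e) ⟩
  2 * 2 ^ j * (a ^ suc a * a ^ e)             ≡⟨ interchange-* 2 (2 ^ j) (a ^ suc a) (a ^ e) ⟩
  (2 * a ^ suc a) * (2 ^ j * a ^ e)           ≤⟨ *-mono-≤ (bernoulli-halving a) (bernoulli-halving-iterated a j r) ⟩
  suc a ^ suc a * suc a ^ e                   ≡⟨ ^-distribˡ-+-* (suc a) (suc a) e ⟨
  suc a ^ (suc a + e)                         ≡⟨ cong (suc a ^_) (+-assoc (suc a) (j * suc a) r) ⟨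
  suc a ^ ((suc a + j * suc a) + r)           ∎
  where
  open ≤-Reasoning
  e = j * suc a + r
  interchange-* : ∀ x y z w → x * y * (z * w) ≡ (x * z) * (y * w)
  interchange-* = solve-∀

missing-fraction : ∀ n k m → suc m ≤ 2 ^ n → 2 * (2 ^ n * n) ≤ k →
  suc m * (2 ^ n * pred (2 ^ n) ^ k) ≤ 2 ^ (n * k)
missing-fraction n k m 1+m≤2ⁿ 2n2ⁿ≤k = begin
  suc m * (2 ^ n * a ^ k)          ≤⟨ *-monoˡ-≤ (2 ^ n * a ^ k) 1+m≤2ⁿ ⟩
  2 ^ n * (2 ^ n * a ^ k)          ≡⟨ *-assoc (2 ^ n) (2 ^ n) (a ^ k) ⟨
  2 ^ n * 2 ^ n * a ^ k            ≡⟨ cong (_* a ^ k) (^-distribˡ-+-* 2 n n) ⟨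
  2 ^ (n + n) * a ^ k              ≡⟨ cong (λ l → 2 ^ (n + n) * a ^ l) k≡ ⟨
  2 ^ (n + n) * a ^ l              ≤⟨ bernoulli-halving-iterated a (n + n) (k ∸ (n + n) * suc a) ⟩
  suc a ^ l                        ≡⟨ cong₂ _^_ 1+a≡2ⁿ k≡ ⟩
  (2 ^ n) ^ k                      ≡⟨ ^-*-assoc 2 n k ⟩
  2 ^ (n * k)                      ∎
  where
  open ≤-Reasoning
  a = pred (2 ^ n)
  1+a≡2ⁿ : suc a ≡ 2 ^ n
  1+a≡2ⁿ = suc-pred (2 ^ n) {{m^n≢0 2 n}}
  regroup : ∀ n Q → (n + n) * Q ≡ 2 * (Q * n)
  regroup = solve-∀
  l = (n + n) * suc a + (k ∸ (n + n) * suc a)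
  k≡ : l ≡ k
  k≡ = m+[n∸m]≡n (≤-trans (≤-reflexive (trans (cong ((n + n) *_) 1+a≡2ⁿ) (regroup n (2 ^ n)))) 2n2ⁿ≤k)

n<2^n : ∀ n → n < 2 ^ n
n<2^n zero    = s≤s z≤n
n<2^n (suc n) = begin-strict
  suc n           ≡⟨ +-comm 1 n ⟩
  n + 1           <⟨ +-monoˡ-< 1 (n<2^n n) ⟩
  2 ^ n + 1       ≤⟨ +-monoʳ-≤ (2 ^ n) (≤-trans (m^n>0 2 n) (m≤m+n (2 ^ n) 0)) ⟩
  2 ^ suc n       ∎
  where open ≤-Reasoning

fraction-bound : ∀ m {total good bad} → total ≤ good + bad → suc m * bad ≤ total → m * total ≤ suc m * good
fraction-bound m {total} {good} {bad} total≤ bad≤ = +-cancelˡ-≤ total _ _ (begin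
  suc m * total                    ≤⟨ *-monoʳ-≤ (suc m) total≤ ⟩
  suc m * (good + bad)             ≡⟨ *-distribˡ-+ (suc m) good bad ⟩
  suc m * good + suc m * bad       ≤⟨ +-monoʳ-≤ (suc m * good) bad≤ ⟩
  suc m * good + total             ≡⟨ +-comm (suc m * good) total ⟩
  total + suc m * good             ∎)
  where open ≤-Reasoning

theorem4p6 : (k : ℕ → ℕ)
    → (∀ (M : ℕ) → ∃[ N ] ∀ n → N ≤ n → M * (2 ^ n * n) ≤ k n)
    → ∀ (m : ℕ) → ∃[ N ] ∀ n → N ≤ n → m * 2 ^ (n * k n) ≤ suc m * splitCount n (k n)
theorem4p6 k k-large m with k-large 2
... | N , 2n2ⁿ≤k = N ⊔ suc m , λ n N⊔1+m≤n →
  fraction-bound m (splitCount-union-bound n (k n)) (missing-fraction n (k n) m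
    (≤-trans (m⊔n≤o⇒n≤o N (suc m) N⊔1+m≤n) (<⇒≤ (n<2^n n)))
    (2n2ⁿ≤k n (m⊔n≤o⇒m≤o N (suc m) N⊔1+m≤n)))
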